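{- Let $A$ be a finite alphabet. Considered both as families of languages (defined by sentences) and as families of sets of marked words (defined by formulas with one free variable), the logics $FO^2[<,\mathrm{bet}]$ and $FO^2[<,\mathrm{th}]$ over $A$ have the same expressive power: every sentence (resp. formula with one free variable) of one logic is equivalent to a sentence (resp. formula with one free variable) of the other.
   Context: Words over a finite alphabet $A$ are interpreted as finite structures whose positions are $1,\dots,|w|$; $w(i)$ is the $i$-th letter. A marked word is a pair $(w,i)$ with $w$ nonempty and $1\le i\le |w|$. In first-order logic over words, for each $a\in A$ there is a unary predicate $a(x)$ ("the letter at position $x$ is $a$") and the binary order $<$ on positions. Sentences may be evaluated in the empty word, where every existentially quantified sentence is false. $FO^2[<,\mathrm{bet}]$ consists of the first-order formulas that use only two variable symbols (which may be reused/requantified), built from $x<y$, the unary predicates $a(x)$, and for each $a\in A$ the binary predicate $a(x,y)$, interpreted as: there is a position $z$ with $x<z<y$ and $w(z)=a$. $FO^2[<,\mathrm{th}]$ is the two-variable logic built from $<$, the unary letter predicates and, for each $a\in A$ and each integer $k\ge 0$, the binary predicate $(a,k)(x,y)$, interpreted as: $x<y$ and there are at least $k$ positions $z$ with $x<z<y$ and $w(z)=a$. -}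

module Defs where

open import Data.Nat using (ℕ; zero; suc; _<_; _≤_; _<?_)
open import Data.Fin using (Fin)
import Data.Fin as F
open import Data.List using (List; []; _∷_; length; filter; upTo; map)
open import Data.Maybe using (Maybe; just; nothing)
import Data.Maybe.Properties as MP
open import Data.Product using (Σ; _×_; _,_)
open import Data.Sum using (_⊎_)
open import Relation.Nullary using (¬_; Dec; yes; no)
open import Relation.Nullary.Decidable using (_×-dec_)
open import Relation.Binary.PropositionalEquality using (_≡_; refl)
open import Function.Bundles using (_⇔_)

data Var : Set where
  x y : Var

_≟V_ : (u v : Var) → Dec (u ≡ v)
x ≟V x = yes refl
x ≟V y = no λ ()
y ≟V x = no λ ()
y ≟V y = yes refl

data Form (n : ℕ) (B : Set) : Set where
  lt     : Var → Var → Form n B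
  letter : Fin n → Var → Form n B
  bin    : B → Var → Var → Form n B
  ¬'_    : Form n B → Form n B
  _∧'_   : Form n B → Form n B → Form n B
  _∨'_   : Form n B → Form n B → Form n B
  ∃'     : Var → Form n B → Form n B
  ∀'     : Var → Form n B → Form n B

-- FO²[<,bet]: binary predicates a(x,y), a ∈ A.
FObet : ℕ → Set
FObet n = Form n (Fin n)

-- FO²[<,th]: binary predicates (a,k)(x,y), a ∈ A, k ≥ 0.
FOth : ℕ → Set
FOth n = Form n (Fin n × ℕ)

Free : ∀ {n B} → Var → Form n B → Set
Free v (lt u u')     = v ≡ u ⊎ v ≡ u'
Free v (letter _ u)  = v ≡ u
Free v (bin _ u u')  = v ≡ u ⊎ v ≡ u'
Free v (¬' φ)        = Free v φ
Free v (φ ∧' ψ)      = Free v φ ⊎ Free v ψ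
Free v (φ ∨' ψ)      = Free v φ ⊎ Free v ψ
Free v (∃' u φ)      = ¬ (v ≡ u) × Free v φ
Free v (∀' u φ)      = ¬ (v ≡ u) × Free v φ

IsSentence : ∀ {n B} → Form n B → Set
IsSentence φ = ∀ v → ¬ Free v φ

IsFormula1 : ∀ {n B} → Form n B → Set
IsFormula1 φ = ∀ v → Free v φ → v ≡ x

Word : ℕ → Set
Word n = List (Fin n)

-- letter at a 1-based position (nothing if out of range)
letterAt : ∀ {n} → Word n → ℕ → Maybe (Fin n)
letterAt []      _             = nothing
letterAt (c ∷ w) zero          = nothing
letterAt (c ∷ w) (suc zero)    = just c
letterAt (c ∷ w) (suc (suc k)) = letterAt w (suc k)

positions : ∀ {n} → Word n → List ℕ
positions w = map suc (upTo (length w))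

countBetween : ∀ {n} → Word n → Fin n → ℕ → ℕ → ℕ
countBetween w a i j =
  length (filter (λ z → (i <? z) ×-dec ((z <? j) ×-dec MP.≡-dec F._≟_ (letterAt w z) (just a)))
                 (positions w))

betSem : ∀ {n} → Word n → Fin n → ℕ → ℕ → Set
betSem w a i j = Σ ℕ λ z → i < z × z < j × letterAt w z ≡ just a

thSem : ∀ {n} → Word n → Fin n × ℕ → ℕ → ℕ → Set
thSem w (a , k) i j = i < j × k ≤ countBetween w a i j

Env : Set
Env = Var → ℕ

_[_↦_] : Env → Var → ℕ → Env
(ν [ u ↦ i ]) v with v ≟V u
... | yes _ = i
... | no  _ = ν v

-- satisfaction; positions are 1 … |w|, quantifiers range over them
Sat : ∀ {n B} → (Word n → B → ℕ → ℕ → Set) → Word n → Env → Form n B → Set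
Sat I w ν (lt u v)     = ν u < ν v
Sat I w ν (letter a u) = letterAt w (ν u) ≡ just a
Sat I w ν (bin b u v)  = I w b (ν u) (ν v)
Sat I w ν (¬' φ)       = ¬ Sat I w ν φ
Sat I w ν (φ ∧' ψ)     = Sat I w ν φ × Sat I w ν ψ
Sat I w ν (φ ∨' ψ)     = Sat I w ν φ ⊎ Sat I w ν ψ
Sat I w ν (∃' u φ)     = Σ ℕ λ i → 1 ≤ i × i ≤ length w × Sat I w (ν [ u ↦ i ]) φ
Sat I w ν (∀' u φ)     = (i : ℕ) → 1 ≤ i → i ≤ length w → Sat I w (ν [ u ↦ i ]) φ

-- word satisfies a sentence (the environment is irrelevant for sentences;
-- a fixed default is used, also for the empty word)
_⊨bet_ : ∀ {n} → Word n → FObet n → Set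
w ⊨bet φ = Sat betSem w (λ _ → 0) φ

_⊨th_ : ∀ {n} → Word n → FOth n → Set
w ⊨th φ = Sat thSem w (λ _ → 0) φ

-- marked word (w,i), 1 ≤ i ≤ |w|, satisfies φ(x)
MarkedSatBet : ∀ {n} → Word n → ℕ → FObet n → Set
MarkedSatBet w i φ = Sat betSem w (λ _ → i) φ

MarkedSatTh : ∀ {n} → Word n → ℕ → FOth n → Set
MarkedSatTh w i φ = Sat thSem w (λ _ → i) φ

SentEquiv : ∀ {n} → FObet n → FOth n → Set
SentEquiv {n} φ ψ = (w : Word n) → (w ⊨bet φ) ⇔ (w ⊨th ψ)

Form1Equiv : ∀ {n} → FObet n → FOth n → Set
Form1Equiv {n} φ ψ = (w : Word n) (i : ℕ) → 1 ≤ i → i ≤ length w →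
  MarkedSatBet w i φ ⇔ MarkedSatTh w i ψ

-- Reading a(x,y) as (a,1)(x,y) embeds FO²[<,bet] into FO²[<,th]; the work is the
-- converse, done bottom-up one quantifier at a time. Below ∃y, a formula is a Boolean
-- combination of x < y, y < x, (a,k)(x,y), (a,k)(y,x) and of already translated formulas
-- in x alone or in y alone. The formulas in x are fixed by a case split (Shannon
-- expansion), and y is sought after x, before x, or at x. A witness y after x is reached
-- either without passing any letter a still required by some (a,k)(x,y) with k ≥ 1, in
-- which case every threshold atom is decided and the condition is ¬ a(x,y) for those
-- letters, or through the nearest position z carrying such a letter. Seen from z the
-- thresholds on the letter at z drop by one; swapping the names of the variables lets x
-- denote z, and the search goes on from there. The sum of the thresholds bounds the
-- recursion.

module Submission where

open import Defs
open import Data.Bool using (Bool; true; false; if_then_else_; _∧_)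
open import Data.Empty using (⊥; ⊥-elim)
open import Data.Fin using (Fin)
import Data.Fin as F
open import Data.List using (List; []; _∷_; _++_; length; filter; map; concatMap)
import Data.List.Membership.DecPropositional as DecMembership
open import Data.List.Membership.Propositional using (_∈_; lose; find)
open import Data.List.Membership.Propositional.Properties
  using (∈-filter⁻; ∈-map⁺; ∈-upTo⁺; ∈-++⁺ˡ; ∈-++⁺ʳ; ∈-concatMap⁺; ∈-concatMap⁻)
open import Data.List.Properties using (filter-some; filter-none; filter-accept; filter-reject; map-++; map-∘)
open import Data.List.Relation.Unary.All as All using (All; []; _∷_)
open import Data.List.Relation.Unary.Any as Any using (Any; here; there)
open import Data.List.Relation.Unary.Unique.Propositional using (Unique; _∷_)
import Data.List.Relation.Unary.Unique.Propositional.Properties as Unique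
open import Data.Maybe using (just; nothing)
import Data.Maybe.Properties as MP
open import Data.Nat using (ℕ; zero; suc; pred; _+_; _<_; _≤_; _<?_; _≤?_; z≤n; s≤s; s≤s⁻¹; anyUpTo?; allUpTo?)
open import Data.Nat.ListAction using (sum)
open import Data.Nat.Properties
open import Data.Product using (Σ; ∃; _×_; _,_; proj₁; proj₂)
open import Data.Product.Function.NonDependent.Propositional using (_×-⇔_)
open import Data.Sum using (_⊎_; inj₁; inj₂; [_,_]′)
open import Data.Sum.Function.Propositional using (_⊎-⇔_)
open import Data.Unit using (⊤; tt)
open import Function using (_∘_; id)
open import Function.Bundles using (_⇔_; mk⇔; Equivalence)
open import Function.Construct.Composition using (_⇔-∘_)
open import Function.Construct.Identity using (⇔-id)
open import Function.Construct.Symmetry using (⇔-sym)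
open import Function.Related.Propositional using (module EquationalReasoning; ≡⇒; equivalence)
open import Function.Related.TypeIsomorphisms using (¬-cong-⇔)
open import Relation.Binary.Definitions using (tri<; tri≈; tri>)
open import Relation.Binary.PropositionalEquality
  using (_≡_; _≢_; _≗_; refl; sym; trans; cong; cong₂; subst; module ≡-Reasoning)
open import Relation.Nullary using (¬_; Dec; yes; no; does)
open import Relation.Nullary.Decidable using (_×-dec_; _⊎-dec_; _→-dec_; ¬?; map′)
open import Relation.Unary using (Decidable)

open Equivalence using (to; from)

private
  variable
    n : ℕ
    A B C L : Set

⊥-⇔ : {P Q : Set} → ¬ P → ¬ Q → P ⇔ Q
⊥-⇔ ¬p ¬q = mk⇔ (⊥-elim ∘ ¬p) (⊥-elim ∘ ¬q)

⊤-⇔ : {P Q : Set} → P → Q → P ⇔ Q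
⊤-⇔ p q = mk⇔ (λ _ → q) (λ _ → p)

≡⇒⇔ : {P Q : Set} → P ≡ Q → P ⇔ Q
≡⇒⇔ = ≡⇒ {k = equivalence}

other : Var → Var
other x = y
other y = x

other-involutive : ∀ v → other (other v) ≡ v
other-involutive x = refl
other-involutive y = refl

other≡⇒≡other : ∀ {u v} → other v ≡ u → v ≡ other u
other≡⇒≡other {v = v} refl = sym (other-involutive v)

other-≢ : ∀ v → other v ≢ v
other-≢ x ()
other-≢ y ()

≢⇒≡other : ∀ {u v} → v ≢ u → v ≡ other u
≢⇒≡other {x} {x} v≢u = ⊥-elim (v≢u refl)
≢⇒≡other {x} {y} _   = refl
≢⇒≡other {y} {x} _   = refl
≢⇒≡other {y} {y} v≢u = ⊥-elim (v≢u refl)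

⟨_,_⟩ : ℕ → ℕ → Env
⟨ i , j ⟩ x = i
⟨ i , j ⟩ y = j

[↦]-same : ∀ (ν : Env) u j → (ν [ u ↦ j ]) u ≡ j
[↦]-same ν x j = refl
[↦]-same ν y j = refl

[↦]-cong : ∀ {ν ν′ : Env} u j v → (v ≢ u → ν v ≡ ν′ v) → (ν [ u ↦ j ]) v ≡ (ν′ [ u ↦ j ]) v
[↦]-cong x j x _ = refl
[↦]-cong x j y h = h λ ()
[↦]-cong y j x h = h λ ()
[↦]-cong y j y _ = refl

[y↦]≗ : ∀ (ν : Env) j → ν [ y ↦ j ] ≗ ⟨ ν x , j ⟩
[y↦]≗ ν j x = refl
[y↦]≗ ν j y = refl

Somewhere : Word n → (ℕ → Set) → Set
Somewhere w P = Σ ℕ λ j → 1 ≤ j × j ≤ length w × P j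

Everywhere : Word n → (ℕ → Set) → Set
Everywhere w P = ∀ j → 1 ≤ j → j ≤ length w → P j

module _ (w : Word n) {P Q : ℕ → Set} where

  Somewhere-cong : (∀ j → P j ⇔ Q j) → Somewhere w P ⇔ Somewhere w Q
  Somewhere-cong P⇔Q = mk⇔ (λ (j , l , u , p) → j , l , u , to (P⇔Q j) p)
                           (λ (j , l , u , q) → j , l , u , from (P⇔Q j) q)

  Everywhere-cong : (∀ j → P j ⇔ Q j) → Everywhere w P ⇔ Everywhere w Q
  Everywhere-cong P⇔Q = mk⇔ (λ p j l u → to (P⇔Q j) (p j l u))
                            (λ q j l u → from (P⇔Q j) (q j l u))

module _ (w : Word n) {P : ℕ → Set} (P? : Decidable P) where

  Somewhere? : Dec (Somewhere w P)
  Somewhere? = map′ (λ (j , j<1+L , 1≤j , p) → j , 1≤j , ≤-pred j<1+L , p)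
                    (λ (j , 1≤j , j≤L , p) → j , s≤s j≤L , 1≤j , p)
                    (anyUpTo? (λ j → 1 ≤? j ×-dec P? j) (suc (length w)))

  Everywhere? : Dec (Everywhere w P)
  Everywhere? = map′ (λ p j 1≤j j≤L → p (s≤s j≤L) 1≤j)
                     (λ p {j} j<1+L 1≤j → p j 1≤j (≤-pred j<1+L))
                     (allUpTo? (λ j → 1 ≤? j →-dec P? j) (suc (length w)))

  Everywhere⇔¬Somewhere¬ : Everywhere w P ⇔ (¬ Somewhere w (¬_ ∘ P))
  Everywhere⇔¬Somewhere¬ = mk⇔ (λ p (j , l , u , ¬pj) → ¬pj (p j l u)) everywhere
    where
    everywhere : ¬ Somewhere w (¬_ ∘ P) → Everywhere w P
    everywhere ¬s j l u with P? j
    ... | yes pj = pj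
    ... | no ¬pj = ⊥-elim (¬s (j , l , u , ¬pj))

None : (ℕ → Set) → ℕ → ℕ → Set
None Q i j = ∀ z → i < z → z < j → ¬ Q z

None-extend : ∀ {Q i j} → None Q i j → ¬ (i < j × Q j) → None Q i (suc j)
None-extend none ¬Qj z i<z z<1+j qz with m≤n⇒m<n∨m≡n (≤-pred z<1+j)
... | inj₁ z<j  = none z i<z z<j qz
... | inj₂ refl = ¬Qj (i<z , qz)

module _ {Q : ℕ → Set} (Q? : Decidable Q) where

  least-between : ∀ i j → None Q i j ⊎ Σ ℕ λ z → i < z × z < j × Q z × None Q i z
  least-between i zero = inj₁ λ _ _ ()
  least-between i (suc j) with least-between i j
  ... | inj₂ (z , i<z , z<j , qz , none) = inj₂ (z , i<z , m<n⇒m<1+n z<j , qz , none)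
  ... | inj₁ none with i <? j ×-dec Q? j
  ...   | yes (i<j , qj) = inj₂ (j , i<j , ≤-refl , qj , none)
  ...   | no ¬Qj         = inj₁ (None-extend none ¬Qj)

  greatest-between : ∀ i j → None Q i j ⊎ Σ ℕ λ z → i < z × z < j × Q z × None Q z j
  greatest-between i zero = inj₁ λ _ _ ()
  greatest-between i (suc j) with i <? j ×-dec Q? j
  ... | yes (i<j , qj) =
          inj₂ (j , i<j , ≤-refl , qj , None-extend (λ _ j<z z<j → ⊥-elim (<-asym j<z z<j)) (<-irrefl refl ∘ proj₁))
  ... | no ¬Qj with greatest-between i j
  ...   | inj₁ none = inj₁ (None-extend none ¬Qj)
  ...   | inj₂ (z , i<z , z<j , qz , none) =
          inj₂ (z , i<z , m<n⇒m<1+n z<j , qz , None-extend none λ (_ , qj) → ¬Qj (<-trans i<z z<j , qj))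

OnlyFree : {B : Set} → Var → Form n B → Set
OnlyFree v φ = ∀ u → Free u φ → u ≡ v

∃-onlyFree : ∀ {B} u (φ : Form n B) → OnlyFree (other u) (∃' u φ)
∃-onlyFree u φ v (v≢u , _) = ≢⇒≡other v≢u

swapVars : {B : Set} → Form n B → Form n B
swapVars (lt u v)     = lt (other u) (other v)
swapVars (letter a u) = letter a (other u)
swapVars (bin b u v)  = bin b (other u) (other v)
swapVars (¬' φ)       = ¬' swapVars φ
swapVars (φ ∧' ψ)     = swapVars φ ∧' swapVars ψ
swapVars (φ ∨' ψ)     = swapVars φ ∨' swapVars ψ
swapVars (∃' u φ)     = ∃' (other u) (swapVars φ)
swapVars (∀' u φ)     = ∀' (other u) (swapVars φ)

Free-swapVars : ∀ {B} (φ : Form n B) v → Free v (swapVars φ) → Free (other v) φ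
Free-swapVars (lt u u′)    v (inj₁ refl) = inj₁ (other-involutive u)
Free-swapVars (lt u u′)    v (inj₂ refl) = inj₂ (other-involutive u′)
Free-swapVars (letter a u) v refl        = other-involutive u
Free-swapVars (bin b u u′) v (inj₁ refl) = inj₁ (other-involutive u)
Free-swapVars (bin b u u′) v (inj₂ refl) = inj₂ (other-involutive u′)
Free-swapVars (¬' φ)       v f           = Free-swapVars φ v f
Free-swapVars (φ ∧' ψ)     v (inj₁ f)    = inj₁ (Free-swapVars φ v f)
Free-swapVars (φ ∧' ψ)     v (inj₂ f)    = inj₂ (Free-swapVars ψ v f)
Free-swapVars (φ ∨' ψ)     v (inj₁ f)    = inj₁ (Free-swapVars φ v f)
Free-swapVars (φ ∨' ψ)     v (inj₂ f)    = inj₂ (Free-swapVars ψ v f)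
Free-swapVars (∃' u φ)     v (v≢ou , f)  = v≢ou ∘ other≡⇒≡other , Free-swapVars φ v f
Free-swapVars (∀' u φ)     v (v≢ou , f)  = v≢ou ∘ other≡⇒≡other , Free-swapVars φ v f

swapVars-onlyFree : ∀ {B v} (φ : Form n B) → OnlyFree v φ → OnlyFree (other v) (swapVars φ)
swapVars-onlyFree φ h u f = other≡⇒≡other (h (other u) (Free-swapVars φ u f))

Free? : ∀ {B} v (φ : Form n B) → Dec (Free v φ)
Free? v (lt u u′)    = (v ≟V u) ⊎-dec (v ≟V u′)
Free? v (letter a u) = v ≟V u
Free? v (bin b u u′) = (v ≟V u) ⊎-dec (v ≟V u′)
Free? v (¬' φ)       = Free? v φ
Free? v (φ ∧' ψ)     = Free? v φ ⊎-dec Free? v ψ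
Free? v (φ ∨' ψ)     = Free? v φ ⊎-dec Free? v ψ
Free? v (∃' u φ)     = ¬? (v ≟V u) ×-dec Free? v φ
Free? v (∀' u φ)     = ¬? (v ≟V u) ×-dec Free? v φ

¬Free-other⇒onlyFree : ∀ {B u} (φ : Form n B) → ¬ Free (other u) φ → OnlyFree u φ
¬Free-other⇒onlyFree {u = u} φ ¬free v free with v ≟V u
... | yes v≡u = v≡u
... | no v≢u  = ⊥-elim (¬free (subst (λ t → Free t φ) (≢⇒≡other v≢u) free))

mapBin : ∀ {B B′} → (B → B′) → Form n B → Form n B′
mapBin f (lt u v)     = lt u v
mapBin f (letter a u) = letter a u
mapBin f (bin b u v)  = bin (f b) u v
mapBin f (¬' φ)       = ¬' mapBin f φ
mapBin f (φ ∧' ψ)     = mapBin f φ ∧' mapBin f ψ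
mapBin f (φ ∨' ψ)     = mapBin f φ ∨' mapBin f ψ
mapBin f (∃' u φ)     = ∃' u (mapBin f φ)
mapBin f (∀' u φ)     = ∀' u (mapBin f φ)

Free-mapBin : ∀ {B B′} (f : B → B′) (φ : Form n B) v → Free v (mapBin f φ) → Free v φ
Free-mapBin f (lt u u′)    v fr          = fr
Free-mapBin f (letter a u) v fr          = fr
Free-mapBin f (bin b u u′) v fr          = fr
Free-mapBin f (¬' φ)       v fr          = Free-mapBin f φ v fr
Free-mapBin f (φ ∧' ψ)     v (inj₁ fr)   = inj₁ (Free-mapBin f φ v fr)
Free-mapBin f (φ ∧' ψ)     v (inj₂ fr)   = inj₂ (Free-mapBin f ψ v fr)
Free-mapBin f (φ ∨' ψ)     v (inj₁ fr)   = inj₁ (Free-mapBin f φ v fr)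
Free-mapBin f (φ ∨' ψ)     v (inj₂ fr)   = inj₂ (Free-mapBin f ψ v fr)
Free-mapBin f (∃' u φ)     v (v≢u , fr)  = v≢u , Free-mapBin f φ v fr
Free-mapBin f (∀' u φ)     v (v≢u , fr)  = v≢u , Free-mapBin f φ v fr

[↦]-other : ∀ (ν : Env) u j v → (ν [ other u ↦ j ]) (other v) ≡ ((ν ∘ other) [ u ↦ j ]) v
[↦]-other ν x j x = refl
[↦]-other ν x j y = refl
[↦]-other ν y j x = refl
[↦]-other ν y j y = refl

module _ {B : Set} (I : Word n → B → ℕ → ℕ → Set) (w : Word n) where

  Sat-cong : ∀ φ {ν ν′} → (∀ v → Free v φ → ν v ≡ ν′ v) → Sat I w ν φ ⇔ Sat I w ν′ φ
  Sat-cong (lt u v)     eq = ≡⇒⇔ (cong₂ _<_ (eq u (inj₁ refl)) (eq v (inj₂ refl)))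
  Sat-cong (letter a u) eq = ≡⇒⇔ (cong (λ i → letterAt w i ≡ just a) (eq u refl))
  Sat-cong (bin b u v)  eq = ≡⇒⇔ (cong₂ (I w b) (eq u (inj₁ refl)) (eq v (inj₂ refl)))
  Sat-cong (¬' φ)       eq = ¬-cong-⇔ (Sat-cong φ eq)
  Sat-cong (φ ∧' ψ)     eq = Sat-cong φ (λ v → eq v ∘ inj₁) ×-⇔ Sat-cong ψ (λ v → eq v ∘ inj₂)
  Sat-cong (φ ∨' ψ)     eq = Sat-cong φ (λ v → eq v ∘ inj₁) ⊎-⇔ Sat-cong ψ (λ v → eq v ∘ inj₂)
  Sat-cong (∃' u φ)     eq = Somewhere-cong w λ j → Sat-cong φ λ v f → [↦]-cong u j v λ v≢u → eq v (v≢u , f)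
  Sat-cong (∀' u φ)     eq = Everywhere-cong w λ j → Sat-cong φ λ v f → [↦]-cong u j v λ v≢u → eq v (v≢u , f)

  Sat-≗ : ∀ φ {ν ν′} → ν ≗ ν′ → Sat I w ν φ ⇔ Sat I w ν′ φ
  Sat-≗ φ ν≗ν′ = Sat-cong φ λ v _ → ν≗ν′ v

  Sat-onlyFree : ∀ {v} φ {ν ν′} → OnlyFree v φ → ν v ≡ ν′ v → Sat I w ν φ ⇔ Sat I w ν′ φ
  Sat-onlyFree φ {ν} {ν′} h eq = Sat-cong φ λ u f → subst (λ t → ν t ≡ ν′ t) (sym (h u f)) eq

  Sat-∃y : ∀ φ ν → Sat I w ν (∃' y φ) ⇔ Somewhere w (λ j → Sat I w ⟨ ν x , j ⟩ φ)
  Sat-∃y φ ν = Somewhere-cong w λ j → Sat-≗ φ ([y↦]≗ ν j)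

  Sat-swapVars : ∀ φ ν → Sat I w ν (swapVars φ) ⇔ Sat I w (ν ∘ other) φ
  Sat-swapVars (lt u v)     ν = ⇔-id _
  Sat-swapVars (letter a u) ν = ⇔-id _
  Sat-swapVars (bin b u v)  ν = ⇔-id _
  Sat-swapVars (¬' φ)       ν = ¬-cong-⇔ (Sat-swapVars φ ν)
  Sat-swapVars (φ ∧' ψ)     ν = Sat-swapVars φ ν ×-⇔ Sat-swapVars ψ ν
  Sat-swapVars (φ ∨' ψ)     ν = Sat-swapVars φ ν ⊎-⇔ Sat-swapVars ψ ν
  Sat-swapVars (∃' u φ)     ν = Somewhere-cong w λ j →
    Sat-≗ φ ([↦]-other ν u j) ⇔-∘ Sat-swapVars φ (ν [ other u ↦ j ])
  Sat-swapVars (∀' u φ)     ν = Everywhere-cong w λ j →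
    Sat-≗ φ ([↦]-other ν u j) ⇔-∘ Sat-swapVars φ (ν [ other u ↦ j ])

  Sat-mapBin : ∀ {B′} (I′ : Word n → B′ → ℕ → ℕ → Set) (f : B → B′) →
    (∀ b i j → I w b i j ⇔ I′ w (f b) i j) → ∀ φ ν → Sat I w ν φ ⇔ Sat I′ w ν (mapBin f φ)
  Sat-mapBin I′ f I⇔I′ (lt u v)     ν = ⇔-id _
  Sat-mapBin I′ f I⇔I′ (letter a u) ν = ⇔-id _
  Sat-mapBin I′ f I⇔I′ (bin b u v)  ν = I⇔I′ b (ν u) (ν v)
  Sat-mapBin I′ f I⇔I′ (¬' φ)       ν = ¬-cong-⇔ (Sat-mapBin I′ f I⇔I′ φ ν)
  Sat-mapBin I′ f I⇔I′ (φ ∧' ψ)     ν = Sat-mapBin I′ f I⇔I′ φ ν ×-⇔ Sat-mapBin I′ f I⇔I′ ψ ν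
  Sat-mapBin I′ f I⇔I′ (φ ∨' ψ)     ν = Sat-mapBin I′ f I⇔I′ φ ν ⊎-⇔ Sat-mapBin I′ f I⇔I′ ψ ν
  Sat-mapBin I′ f I⇔I′ (∃' u φ)     ν = Somewhere-cong w λ j → Sat-mapBin I′ f I⇔I′ φ (ν [ u ↦ j ])
  Sat-mapBin I′ f I⇔I′ (∀' u φ)     ν = Everywhere-cong w λ j → Sat-mapBin I′ f I⇔I′ φ (ν [ u ↦ j ])

  module _ (I? : ∀ b i j → Dec (I w b i j)) where

    Sat? : ∀ ν φ → Dec (Sat I w ν φ)
    Sat? ν (lt u v)     = ν u <? ν v
    Sat? ν (letter a u) = MP.≡-dec F._≟_ (letterAt w (ν u)) (just a)
    Sat? ν (bin b u v)  = I? b (ν u) (ν v)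
    Sat? ν (¬' φ)       = ¬? (Sat? ν φ)
    Sat? ν (φ ∧' ψ)     = Sat? ν φ ×-dec Sat? ν ψ
    Sat? ν (φ ∨' ψ)     = Sat? ν φ ⊎-dec Sat? ν ψ
    Sat? ν (∃' u φ)     = Somewhere? w λ j → Sat? (ν [ u ↦ j ]) φ
    Sat? ν (∀' u φ)     = Everywhere? w λ j → Sat? (ν [ u ↦ j ]) φ

-- Counting letters

length-filter-⊎ : ∀ {P Q R : A → Set} (P? : Decidable P) (Q? : Decidable Q) (R? : Decidable R) →
  (∀ z → P z ⇔ (Q z ⊎ R z)) → (∀ {z} → Q z → ¬ R z) →
  ∀ xs → length (filter P? xs) ≡ length (filter Q? xs) + length (filter R? xs)
length-filter-⊎ P? Q? R? split disjoint [] = refl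
length-filter-⊎ P? Q? R? split disjoint (z ∷ zs) with ih ← length-filter-⊎ P? Q? R? split disjoint zs | P? z | Q? z | R? z
... | yes _  | yes qz | yes rz = ⊥-elim (disjoint qz rz)
... | yes _  | yes _  | no _   = cong suc ih
... | yes _  | no _   | yes _  = trans (cong suc ih) (sym (+-suc _ _))
... | yes pz | no ¬qz | no ¬rz = ⊥-elim ([ ¬qz , ¬rz ]′ (to (split z) pz))
... | no ¬pz | yes qz | _      = ⊥-elim (¬pz (from (split z) (inj₁ qz)))
... | no ¬pz | no _   | yes rz = ⊥-elim (¬pz (from (split z) (inj₂ rz)))
... | no _   | no _   | no _   = ih

length-filter-unique : ∀ {Q : A → Set} (Q? : Decidable Q) {z xs} → Unique xs → z ∈ xs →
  (∀ {t} → Q t ⇔ t ≡ z) → length (filter Q? xs) ≡ 1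
length-filter-unique Q? {xs = t ∷ ts} (t∉ts ∷ _) (here refl) Q⇔ =
  trans (cong length (filter-accept Q? (from Q⇔ refl)))
        (cong (suc ∘ length) (filter-none Q? (All.map (λ t≢s qs → t≢s (sym (to Q⇔ qs))) t∉ts)))
length-filter-unique Q? {xs = t ∷ ts} (t∉ts ∷ uts) (there z∈ts) Q⇔ =
  trans (cong length (filter-reject Q? λ qt → All.lookup t∉ts z∈ts (to Q⇔ qt)))
        (length-filter-unique Q? uts z∈ts Q⇔)

nonempty⇒∈ : ∀ (xs : List A) → 1 ≤ length xs → ∃ (_∈ xs)
nonempty⇒∈ (z ∷ _) _ = z , here refl

letterAt-range : ∀ (w : Word n) z {c} → letterAt w z ≡ just c → 1 ≤ z × z ≤ length w
letterAt-range (c ∷ w) (suc zero)    _  = s≤s z≤n , s≤s z≤n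
letterAt-range (c ∷ w) (suc (suc z)) eq = s≤s z≤n , s≤s (proj₂ (letterAt-range w (suc z) eq))

letterAt⇒∈positions : ∀ (w : Word n) {z c} → letterAt w z ≡ just c → z ∈ positions w
letterAt⇒∈positions w {z} eq with letterAt-range w z eq
... | s≤s _ , z≤length = ∈-map⁺ suc (∈-upTo⁺ z≤length)

positions-unique : (w : Word n) → Unique (positions w)
positions-unique w = Unique.map⁺ suc-injective (Unique.upTo⁺ (length w))

module _ (w : Word n) (a : Fin n) where
  open ≡-Reasoning

  Between : ℕ → ℕ → ℕ → Set
  Between i j t = i < t × t < j × letterAt w t ≡ just a

  between? : ∀ i j → Decidable (Between i j)
  between? i j z = (i <? z) ×-dec ((z <? j) ×-dec MP.≡-dec F._≟_ (letterAt w z) (just a))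

  countBetween⇒betSem : ∀ {i j} → 1 ≤ countBetween w a i j → betSem w a i j
  countBetween⇒betSem {i} {j} 1≤count with z , z∈ ← nonempty⇒∈ (filter (between? i j) (positions w)) 1≤count =
    z , proj₂ (∈-filter⁻ (between? i j) {xs = positions w} z∈)

  betSem⇒countBetween : ∀ {i j} → betSem w a i j → 1 ≤ countBetween w a i j
  betSem⇒countBetween {i} {j} (z , between@(_ , _ , letter-z)) =
    filter-some (between? i j) (lose (letterAt⇒∈positions w letter-z) between)

  ¬betSem⇒countBetween≡0 : ∀ {i j} → ¬ betSem w a i j → countBetween w a i j ≡ 0
  ¬betSem⇒countBetween≡0 ¬between = n<1⇒n≡0 (≰⇒> (¬between ∘ countBetween⇒betSem))

  betSem? : ∀ i j → Dec (betSem w a i j)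
  betSem? i j = map′ (λ (z , _ , between) → z , between) (λ (z , between@(_ , z<j , _)) → z , z<j , between)
                     (anyUpTo? (between? i j) j)

  Between-split : ∀ {i z j} t → Between i j t → Between i z t ⊎ (t ≡ z ⊎ Between z j t)
  Between-split {z = z} t (i<t , t<j , at) with <-cmp t z
  ... | tri< t<z _ _ = inj₁ (i<t , t<z , at)
  ... | tri≈ _ t≡z _ = inj₂ (inj₁ t≡z)
  ... | tri> _ _ z<t = inj₂ (inj₂ (z<t , t<j , at))

  Between-before : ∀ {i z j t} → z < j → Between i z t → Between i j t
  Between-before z<j (i<t , t<z , at) = i<t , <-trans t<z z<j , at

  Between-after : ∀ {i z j t} → i < z → Between z j t → Between i j t
  Between-after i<z (z<t , t<j , at) = <-trans i<z z<t , t<j , at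

  Between-disjoint : ∀ {i z j t} → Between i z t → ¬ Between z j t
  Between-disjoint (_ , t<z , _) (z<t , _) = <-asym t<z z<t

  countBetween-split-miss : ∀ {i z j} → i < z → z < j → letterAt w z ≢ just a →
    countBetween w a i j ≡ countBetween w a i z + countBetween w a z j
  countBetween-split-miss {i} {z} {j} i<z z<j ¬a =
    length-filter-⊎ (between? i j) (between? i z) (between? z j) split Between-disjoint (positions w)
    where
    split : ∀ t → Between i j t ⇔ (Between i z t ⊎ Between z j t)
    split t = mk⇔ (λ b → [ inj₁ , [ (λ { refl → ⊥-elim (¬a (proj₂ (proj₂ b))) }) , inj₂ ]′ ]′
                             (Between-split t b))
                  [ Between-before z<j , Between-after i<z ]′

  countBetween-split-hit : ∀ {i z j} → i < z → z < j → letterAt w z ≡ just a →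
    countBetween w a i j ≡ countBetween w a i z + suc (countBetween w a z j)
  countBetween-split-hit {i} {z} {j} i<z z<j a-at-z = begin
    countBetween w a i j
      ≡⟨ length-filter-⊎ (between? i j) (between? i z) at-or-after split Between-disjoint′ (positions w) ⟩
    countBetween w a i z + length (filter at-or-after (positions w))
      ≡⟨ cong (countBetween w a i z +_)
              (length-filter-⊎ at-or-after (_≟ z) (between? z j) (λ _ → ⇔-id _) at-not-after (positions w)) ⟩
    countBetween w a i z + (length (filter (_≟ z) (positions w)) + countBetween w a z j)
      ≡⟨ cong (λ m → countBetween w a i z + (m + countBetween w a z j))
              (length-filter-unique (_≟ z) (positions-unique w) (letterAt⇒∈positions w a-at-z) (⇔-id _)) ⟩
    countBetween w a i z + suc (countBetween w a z j) ∎
    where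
    at-or-after : ∀ t → Dec (t ≡ z ⊎ Between z j t)
    at-or-after t = (t ≟ z) ⊎-dec between? z j t
    at-not-after : ∀ {t} → t ≡ z → ¬ Between z j t
    at-not-after refl (z<z , _) = <-irrefl refl z<z
    split : ∀ t → Between i j t ⇔ (Between i z t ⊎ (t ≡ z ⊎ Between z j t))
    split t = mk⇔ (Between-split t) [ Between-before z<j , [ (λ { refl → i<z , z<j , a-at-z }) , Between-after i<z ]′ ]′
    Between-disjoint′ : ∀ {t} → Between i z t → ¬ (t ≡ z ⊎ Between z j t)
    Between-disjoint′ (_ , t<z , _) (inj₁ refl) = <-irrefl refl t<z
    Between-disjoint′ b (inj₂ b′) = Between-disjoint b b′

thSem? : ∀ (w : Word n) b i j → Dec (thSem w b i j)
thSem? w (a , k) i j = (i <? j) ×-dec (k ≤? countBetween w a i j)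

-- Propositional combinations and Shannon expansion

infix  6 ¬ᵖ_
infixr 5 _∧ᵖ_
infixr 4 _∨ᵖ_

data Proposition (A : Set) : Set where
  atom      : A → Proposition A
  ⊤ᵖ ⊥ᵖ     : Proposition A
  ¬ᵖ_       : Proposition A → Proposition A
  _∧ᵖ_ _∨ᵖ_ : Proposition A → Proposition A → Proposition A

⟦_⟧ : Proposition A → (A → Set) → Set
⟦ atom α ⟧ ρ = ρ α
⟦ ⊤ᵖ ⟧     ρ = ⊤
⟦ ⊥ᵖ ⟧     ρ = ⊥
⟦ ¬ᵖ p ⟧   ρ = ¬ ⟦ p ⟧ ρ
⟦ p ∧ᵖ q ⟧ ρ = ⟦ p ⟧ ρ × ⟦ q ⟧ ρ
⟦ p ∨ᵖ q ⟧ ρ = ⟦ p ⟧ ρ ⊎ ⟦ q ⟧ ρ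

atoms : Proposition A → List A
atoms (atom α) = α ∷ []
atoms ⊤ᵖ       = []
atoms ⊥ᵖ       = []
atoms (¬ᵖ p)   = atoms p
atoms (p ∧ᵖ q) = atoms p ++ atoms q
atoms (p ∨ᵖ q) = atoms p ++ atoms q

mapᵖ : (A → B) → Proposition A → Proposition B
mapᵖ f (atom α) = atom (f α)
mapᵖ f ⊤ᵖ       = ⊤ᵖ
mapᵖ f ⊥ᵖ       = ⊥ᵖ
mapᵖ f (¬ᵖ p)   = ¬ᵖ mapᵖ f p
mapᵖ f (p ∧ᵖ q) = mapᵖ f p ∧ᵖ mapᵖ f q
mapᵖ f (p ∨ᵖ q) = mapᵖ f p ∨ᵖ mapᵖ f q

⟦⟧-cong : ∀ p {ρ σ : A → Set} → (∀ {α} → α ∈ atoms p → ρ α ⇔ σ α) → ⟦ p ⟧ ρ ⇔ ⟦ p ⟧ σ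
⟦⟧-cong (atom α) ρ⇔σ = ρ⇔σ (here refl)
⟦⟧-cong ⊤ᵖ       ρ⇔σ = ⇔-id _
⟦⟧-cong ⊥ᵖ       ρ⇔σ = ⇔-id _
⟦⟧-cong (¬ᵖ p)   ρ⇔σ = ¬-cong-⇔ (⟦⟧-cong p ρ⇔σ)
⟦⟧-cong (p ∧ᵖ q) ρ⇔σ = ⟦⟧-cong p (ρ⇔σ ∘ ∈-++⁺ˡ) ×-⇔ ⟦⟧-cong q (ρ⇔σ ∘ ∈-++⁺ʳ (atoms p))
⟦⟧-cong (p ∨ᵖ q) ρ⇔σ = ⟦⟧-cong p (ρ⇔σ ∘ ∈-++⁺ˡ) ⊎-⇔ ⟦⟧-cong q (ρ⇔σ ∘ ∈-++⁺ʳ (atoms p))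

⟦mapᵖ⟧ : ∀ (f : A → B) p ρ → ⟦ mapᵖ f p ⟧ ρ ≡ ⟦ p ⟧ (ρ ∘ f)
⟦mapᵖ⟧ f (atom α) ρ = refl
⟦mapᵖ⟧ f ⊤ᵖ       ρ = refl
⟦mapᵖ⟧ f ⊥ᵖ       ρ = refl
⟦mapᵖ⟧ f (¬ᵖ p)   ρ = cong ¬_ (⟦mapᵖ⟧ f p ρ)
⟦mapᵖ⟧ f (p ∧ᵖ q) ρ = cong₂ _×_ (⟦mapᵖ⟧ f p ρ) (⟦mapᵖ⟧ f q ρ)
⟦mapᵖ⟧ f (p ∨ᵖ q) ρ = cong₂ _⊎_ (⟦mapᵖ⟧ f p ρ) (⟦mapᵖ⟧ f q ρ)

atoms-mapᵖ : ∀ (f : A → B) p → atoms (mapᵖ f p) ≡ map f (atoms p)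
atoms-mapᵖ f (atom α) = refl
atoms-mapᵖ f ⊤ᵖ       = refl
atoms-mapᵖ f ⊥ᵖ       = refl
atoms-mapᵖ f (¬ᵖ p)   = atoms-mapᵖ f p
atoms-mapᵖ f (p ∧ᵖ q) = trans (cong₂ _++_ (atoms-mapᵖ f p) (atoms-mapᵖ f q)) (sym (map-++ f (atoms p) (atoms q)))
atoms-mapᵖ f (p ∨ᵖ q) = trans (cong₂ _++_ (atoms-mapᵖ f p) (atoms-mapᵖ f q)) (sym (map-++ f (atoms p) (atoms q)))

data DecisionTree (B L : Set) : Set where
  leaf : L → DecisionTree B L
  node : B → (if-true if-false : DecisionTree B L) → DecisionTree B L

select : (B → Bool) → DecisionTree B L → L
select β (leaf l)     = l
select β (node b t f) = if β b then select β t else select β f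

mapᵗ : (L → C) → DecisionTree B L → DecisionTree B C
mapᵗ g (leaf l)     = leaf (g l)
mapᵗ g (node b t f) = node b (mapᵗ g t) (mapᵗ g f)

_>>=ᵗ_ : DecisionTree B L → (L → DecisionTree B C) → DecisionTree B C
leaf l     >>=ᵗ k = k l
node b t f >>=ᵗ k = node b (t >>=ᵗ k) (f >>=ᵗ k)

select-mapᵗ : ∀ (β : B → Bool) (g : L → C) t → select β (mapᵗ g t) ≡ g (select β t)
select-mapᵗ β g (leaf l) = refl
select-mapᵗ β g (node b t f) with β b
... | true  = select-mapᵗ β g t
... | false = select-mapᵗ β g f

select->>=ᵗ : ∀ (β : B → Bool) (t : DecisionTree B L) (k : L → DecisionTree B C) →
  select β (t >>=ᵗ k) ≡ select β (k (select β t))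
select->>=ᵗ β (leaf l)     k = refl
select->>=ᵗ β (node b t f) k with β b
... | true  = select->>=ᵗ β t k
... | false = select->>=ᵗ β f k

shannon : Proposition (B ⊎ C) → DecisionTree B (Proposition C)
shannon (atom (inj₁ b)) = node b (leaf ⊤ᵖ) (leaf ⊥ᵖ)
shannon (atom (inj₂ c)) = leaf (atom c)
shannon ⊤ᵖ              = leaf ⊤ᵖ
shannon ⊥ᵖ              = leaf ⊥ᵖ
shannon (¬ᵖ p)          = mapᵗ ¬ᵖ_ (shannon p)
shannon (p ∧ᵖ q)        = shannon p >>=ᵗ λ l → mapᵗ (l ∧ᵖ_) (shannon q)
shannon (p ∨ᵖ q)        = shannon p >>=ᵗ λ l → mapᵗ (l ∨ᵖ_) (shannon q)

instantiate : (B → Bool) → Proposition (B ⊎ C) → Proposition C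
instantiate β (atom (inj₁ b)) = if β b then ⊤ᵖ else ⊥ᵖ
instantiate β (atom (inj₂ c)) = atom c
instantiate β ⊤ᵖ              = ⊤ᵖ
instantiate β ⊥ᵖ              = ⊥ᵖ
instantiate β (¬ᵖ p)          = ¬ᵖ instantiate β p
instantiate β (p ∧ᵖ q)        = instantiate β p ∧ᵖ instantiate β q
instantiate β (p ∨ᵖ q)        = instantiate β p ∨ᵖ instantiate β q

select-shannon : ∀ (β : B → Bool) (p : Proposition (B ⊎ C)) → select β (shannon p) ≡ instantiate β p
select-shannon β (atom (inj₁ b)) with β b
... | true  = refl
... | false = refl
select-shannon β (atom (inj₂ c)) = refl
select-shannon β ⊤ᵖ              = refl
select-shannon β ⊥ᵖ              = refl
select-shannon β (¬ᵖ p)          = trans (select-mapᵗ β ¬ᵖ_ (shannon p)) (cong ¬ᵖ_ (select-shannon β p))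
select-shannon β (p ∧ᵖ q)        = begin
  select β (shannon p >>=ᵗ λ l → mapᵗ (l ∧ᵖ_) (shannon q))  ≡⟨ select->>=ᵗ β (shannon p) _ ⟩
  select β (mapᵗ (select β (shannon p) ∧ᵖ_) (shannon q))    ≡⟨ select-mapᵗ β _ (shannon q) ⟩
  select β (shannon p) ∧ᵖ select β (shannon q)
    ≡⟨ cong₂ _∧ᵖ_ (select-shannon β p) (select-shannon β q) ⟩
  instantiate β p ∧ᵖ instantiate β q                        ∎
  where open ≡-Reasoning
select-shannon β (p ∨ᵖ q)        = begin
  select β (shannon p >>=ᵗ λ l → mapᵗ (l ∨ᵖ_) (shannon q))  ≡⟨ select->>=ᵗ β (shannon p) _ ⟩
  select β (mapᵗ (select β (shannon p) ∨ᵖ_) (shannon q))    ≡⟨ select-mapᵗ β _ (shannon q) ⟩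
  select β (shannon p) ∨ᵖ select β (shannon q)
    ≡⟨ cong₂ _∨ᵖ_ (select-shannon β p) (select-shannon β q) ⟩
  instantiate β p ∨ᵖ instantiate β q                        ∎
  where open ≡-Reasoning

⟦instantiate⟧ : ∀ {ρ : B → Set} (ρ? : Decidable ρ) (σ : C → Set) p →
  ⟦ instantiate (does ∘ ρ?) p ⟧ σ ⇔ ⟦ p ⟧ [ ρ , σ ]′
⟦instantiate⟧ ρ? σ (atom (inj₁ b)) with ρ? b
... | yes ρb = ⊤-⇔ tt ρb
... | no ¬ρb = ⊥-⇔ id ¬ρb
⟦instantiate⟧ ρ? σ (atom (inj₂ c)) = ⇔-id _
⟦instantiate⟧ ρ? σ ⊤ᵖ              = ⇔-id _
⟦instantiate⟧ ρ? σ ⊥ᵖ              = ⇔-id _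
⟦instantiate⟧ ρ? σ (¬ᵖ p)          = ¬-cong-⇔ (⟦instantiate⟧ ρ? σ p)
⟦instantiate⟧ ρ? σ (p ∧ᵖ q)        = ⟦instantiate⟧ ρ? σ p ×-⇔ ⟦instantiate⟧ ρ? σ q
⟦instantiate⟧ ρ? σ (p ∨ᵖ q)        = ⟦instantiate⟧ ρ? σ p ⊎-⇔ ⟦instantiate⟧ ρ? σ q

module _ {B : Set} where

  ⊥F ⊤F : Form n B
  ⊥F = ∃' x (lt x x)
  ⊤F = ¬' ⊥F

  ⊥F-closed : ∀ v → ¬ Free v (⊥F {n})
  ⊥F-closed v (v≢x , v≡x) = v≢x ([ id , id ]′ v≡x)

  decF : {P : Set} → Dec P → Form n B
  decF (yes _) = ⊤F
  decF (no _)  = ⊥F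

  realize : (A → Form n B) → Proposition A → Form n B
  realize f (atom α) = f α
  realize f ⊤ᵖ       = ⊤F
  realize f ⊥ᵖ       = ⊥F
  realize f (¬ᵖ p)   = ¬' realize f p
  realize f (p ∧ᵖ q) = realize f p ∧' realize f q
  realize f (p ∨ᵖ q) = realize f p ∨' realize f q

  ⋀ ⋁ : List A → (A → Form n B) → Form n B
  ⋀ []       f = ⊤F
  ⋀ (α ∷ αs) f = f α ∧' ⋀ αs f
  ⋁ []       f = ⊥F
  ⋁ (α ∷ αs) f = f α ∨' ⋁ αs f

  ⋁-onlyFree : ∀ {n v} (αs : List A) (f : A → Form n B) → (∀ α → OnlyFree v (f α)) → OnlyFree v (⋁ αs f)
  ⋁-onlyFree {n = n} []  f h u fr        = ⊥-elim (⊥F-closed {n = n} u fr)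
  ⋁-onlyFree (α ∷ αs) f h u (inj₁ fr) = h α u fr
  ⋁-onlyFree (α ∷ αs) f h u (inj₂ fr) = ⋁-onlyFree αs f h u fr

  module _ (I : Word n → B → ℕ → ℕ → Set) (w : Word n) (ν : Env) where

    Sat-⊥F : ¬ Sat I w ν ⊥F
    Sat-⊥F (_ , _ , _ , i<i) = <-irrefl refl i<i

    Sat-⊤F : Sat I w ν ⊤F
    Sat-⊤F = Sat-⊥F

    Sat-decF : {P : Set} (P? : Dec P) → Sat I w ν (decF P?) ⇔ P
    Sat-decF (yes p) = ⊤-⇔ Sat-⊤F p
    Sat-decF (no ¬p) = ⊥-⇔ Sat-⊥F ¬p

    Sat-realize : ∀ (f : A → Form n B) p → Sat I w ν (realize f p) ⇔ ⟦ p ⟧ (λ α → Sat I w ν (f α))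
    Sat-realize f (atom α) = ⇔-id _
    Sat-realize f ⊤ᵖ       = ⊤-⇔ Sat-⊤F tt
    Sat-realize f ⊥ᵖ       = ⊥-⇔ Sat-⊥F id
    Sat-realize f (¬ᵖ p)   = ¬-cong-⇔ (Sat-realize f p)
    Sat-realize f (p ∧ᵖ q) = Sat-realize f p ×-⇔ Sat-realize f q
    Sat-realize f (p ∨ᵖ q) = Sat-realize f p ⊎-⇔ Sat-realize f q

    Sat-⋀ : ∀ αs (f : A → Form n B) → Sat I w ν (⋀ αs f) ⇔ All (λ α → Sat I w ν (f α)) αs
    Sat-⋀ []       f = ⊤-⇔ Sat-⊤F []
    Sat-⋀ (α ∷ αs) f = mk⇔ (λ (fα , rest) → fα ∷ to (Sat-⋀ αs f) rest)
                           (λ { (fα ∷ rest) → fα , from (Sat-⋀ αs f) rest })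

    Sat-⋁ : ∀ αs (f : A → Form n B) → Sat I w ν (⋁ αs f) ⇔ Any (λ α → Sat I w ν (f α)) αs
    Sat-⋁ []       f = ⊥-⇔ Sat-⊥F λ ()
    Sat-⋁ (α ∷ αs) f = mk⇔ [ here , there ∘ to (Sat-⋁ αs f) ]′
                           λ { (here fα) → inj₁ fα ; (there rest) → inj₂ (from (Sat-⋁ αs f) rest) }

-- Eliminating ∃y

FObet₁ : ℕ → Var → Set
FObet₁ n v = Σ (FObet n) (OnlyFree v)

data Dir : Set where
  fw bw : Dir

_≟ᴰ_ : (d d′ : Dir) → Dec (d ≡ d′)
fw ≟ᴰ fw = yes refl
fw ≟ᴰ bw = no λ ()
bw ≟ᴰ fw = no λ ()
bw ≟ᴰ bw = yes refl

orient : ∀ {ℓ} {I : Set} {R : Set ℓ} → Dir → (I → I → R) → I → I → R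
orient fw f i j = f i j
orient bw f i j = f j i

orient-irrefl : ∀ d {i} → ¬ orient d _<_ i i
orient-irrefl fw = <-irrefl refl
orient-irrefl bw = <-irrefl refl

orient-trans : ∀ d {i z j} → orient d _<_ i z → orient d _<_ z j → orient d _<_ i j
orient-trans fw i<z z<j = <-trans i<z z<j
orient-trans bw z<i j<z = <-trans j<z z<i

ahead-dir : ∀ d d′ {i j} → orient d _<_ i j → orient d′ _<_ i j ⇔ d ≡ d′
ahead-dir fw fw i<j = ⊤-⇔ i<j refl
ahead-dir fw bw i<j = ⊥-⇔ (<-asym i<j) λ ()
ahead-dir bw fw j<i = ⊥-⇔ (<-asym j<i) λ ()
ahead-dir bw bw j<i = ⊤-⇔ j<i refl

-- the atoms below ∃y; fw means that y lies after x, bw that it lies before x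
data Atom (n : ℕ) : Set where
  ahead  : Dir → Atom n
  thresh : Dir → Fin n → ℕ → Atom n
  onY    : FObet₁ n y → Atom n

module _ (d : Dir) where

  positive : Atom n → List (Fin n)
  positive (thresh d′ a (suc k)) = if does (d ≟ᴰ d′) then a ∷ [] else []
  positive _                     = []

  weight : Atom n → ℕ
  weight (thresh d′ a k) = if does (d ≟ᴰ d′) then k else 0
  weight _               = 0

  -- the atom seen from a position with letter c between x and y
  shiftAtom : Fin n → Atom n → Atom n
  shiftAtom c (thresh d′ a k) = thresh d′ a (if does (d ≟ᴰ d′) ∧ does (c F.≟ a) then pred k else k)
  shiftAtom c α               = α

  -- the value of an atom when y lies in direction d and no positive letter lies between x and y
  baseAtom : Atom n → FObet n
  baseAtom (ahead d′)            = decF (d ≟ᴰ d′)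
  baseAtom (thresh d′ a zero)    = decF (d ≟ᴰ d′)
  baseAtom (thresh d′ a (suc k)) = ⊥F
  baseAtom (onY P)               = proj₁ P

  positives : Proposition (Atom n) → List (Fin n)
  positives s = concatMap positive (atoms s)

  measure : Proposition (Atom n) → ℕ
  measure s = sum (map weight (atoms s))

  shift : Fin n → Proposition (Atom n) → Proposition (Atom n)
  shift c = mapᵖ (shiftAtom c)

  aheadF : FObet n
  aheadF = orient d lt x y

  crossesF : Fin n → FObet n
  crossesF c = orient d (bin c) x y

  clearF : Proposition (Atom n) → FObet n
  clearF s = ⋀ (positives s) (¬'_ ∘ crossesF)

  ∃clear : Proposition (Atom n) → FObet n
  ∃clear s = ∃' y (aheadF ∧' (clearF s ∧' realize baseAtom s))

  ∃step : Proposition (Atom n) → Fin n → FObet n → FObet n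
  ∃step s c φ = ∃' y (aheadF ∧' (letter c y ∧' (clearF s ∧' swapVars φ)))

  -- the fuel must be at least measure s (measure-shift-<)
  ∃ahead : ℕ → Proposition (Atom n) → FObet n
  ∃ahead zero    s = ∃clear s
  ∃ahead (suc f) s = ∃clear s ∨' ⋁ (positives s) λ c → ∃step s c (∃ahead f (shift c s))

diagAtom : Atom n → FObet n
diagAtom (onY P) = proj₁ P
diagAtom _       = ⊥F

elimLeaf : Proposition (Atom n) → FObet n
elimLeaf s = ∃ahead fw (measure fw s) s
           ∨' (∃ahead bw (measure bw s) s
           ∨' ∃' y ((¬' lt x y) ∧' ((¬' lt y x) ∧' realize diagAtom s)))

elimTree : DecisionTree (FObet₁ n x) (Proposition (Atom n)) → FObet n
elimTree (leaf s)     = elimLeaf s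
elimTree (node P t f) = (proj₁ P ∧' elimTree t) ∨' ((¬' proj₁ P) ∧' elimTree f)

Skeleton : ℕ → Set
Skeleton n = Proposition (FObet₁ n x ⊎ Atom n)

elim∃y : Skeleton n → FObet n
elim∃y s = elimTree (shannon s)

∃ahead-onlyFree : ∀ d f (s : Proposition (Atom n)) → OnlyFree x (∃ahead d f s)
∃ahead-onlyFree d zero    s u (u≢y , _) = ≢⇒≡other u≢y
∃ahead-onlyFree d (suc f) s u (inj₁ fr) = ∃ahead-onlyFree d zero s u fr
∃ahead-onlyFree d (suc f) s u (inj₂ fr) =
  ⋁-onlyFree (positives d s) (λ c → ∃step d s c (∃ahead d f (shift d c s))) (λ _ _ (u≢y , _) → ≢⇒≡other u≢y) u fr

elimTree-onlyFree : (t : DecisionTree (FObet₁ n x) (Proposition (Atom n))) → OnlyFree x (elimTree t)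
elimTree-onlyFree (leaf s)     u (inj₁ fr)                 = ∃ahead-onlyFree fw (measure fw s) s u fr
elimTree-onlyFree (leaf s)     u (inj₂ (inj₁ fr))          = ∃ahead-onlyFree bw (measure bw s) s u fr
elimTree-onlyFree (leaf s)     u (inj₂ (inj₂ (u≢y , _)))   = ≢⇒≡other u≢y
elimTree-onlyFree (node P t f) u (inj₁ (inj₁ fr))          = proj₂ P u fr
elimTree-onlyFree (node P t f) u (inj₁ (inj₂ fr))          = elimTree-onlyFree t u fr
elimTree-onlyFree (node P t f) u (inj₂ (inj₁ fr))          = proj₂ P u fr
elimTree-onlyFree (node P t f) u (inj₂ (inj₂ fr))          = elimTree-onlyFree f u fr

elim∃y-onlyFree : (s : Skeleton n) → OnlyFree x (elim∃y s)
elim∃y-onlyFree s = elimTree-onlyFree (shannon s)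

sum-map-≤ : ∀ {f g : A → ℕ} xs → All (λ α → g α ≤ f α) xs → sum (map g xs) ≤ sum (map f xs)
sum-map-≤ []       []         = z≤n
sum-map-≤ (α ∷ αs) (≤α ∷ ≤αs) = +-mono-≤ ≤α (sum-map-≤ αs ≤αs)

sum-map-< : ∀ {f g : A → ℕ} xs → All (λ α → g α ≤ f α) xs → Any (λ α → g α < f α) xs →
  sum (map g xs) < sum (map f xs)
sum-map-< (α ∷ αs) (_ ∷ ≤αs)  (here <α)  = +-mono-<-≤ <α (sum-map-≤ αs ≤αs)
sum-map-< (α ∷ αs) (≤α ∷ ≤αs) (there <αs) = +-mono-≤-< ≤α (sum-map-< αs ≤αs <αs)

weight-shiftAtom-≤ : ∀ d c (α : Atom n) → weight d (shiftAtom d c α) ≤ weight d α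
weight-shiftAtom-≤ d c (ahead _)       = z≤n
weight-shiftAtom-≤ d c (thresh d′ a k) with d ≟ᴰ d′ | c F.≟ a
... | yes _ | yes _ = pred[n]≤n
... | yes _ | no _  = ≤-refl
... | no _  | _     = z≤n
weight-shiftAtom-≤ d c (onY _)         = z≤n

weight-shiftAtom-< : ∀ d c (α : Atom n) → c ∈ positive d α → weight d (shiftAtom d c α) < weight d α
weight-shiftAtom-< d c (thresh d′ a (suc k)) c∈ with d ≟ᴰ d′ | c F.≟ a
weight-shiftAtom-< d c (thresh d′ a (suc k)) _          | yes _ | yes _  = ≤-refl
weight-shiftAtom-< d c (thresh d′ a (suc k)) (here c≡a) | yes _ | no c≢a = ⊥-elim (c≢a c≡a)

measure-shift-< : ∀ d {c} (s : Proposition (Atom n)) → c ∈ positives d s → measure d (shift d c s) < measure d s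
measure-shift-< d {c} s c∈ = subst (_< measure d s) (sym measure-shift)
  (sum-map-< (atoms s) (All.universal (weight-shiftAtom-≤ d c) (atoms s))
                       (Any.map (λ {α} → weight-shiftAtom-< d c α) (∈-concatMap⁻ (positive d) c∈)))
  where
  measure-shift : measure d (shift d c s) ≡ sum (map (weight d ∘ shiftAtom d c) (atoms s))
  measure-shift = trans (cong (sum ∘ map (weight d)) (atoms-mapᵖ (shiftAtom d c) s)) (cong sum (sym (map-∘ (atoms s))))

module Semantics (w : Word n) where

  ⟦_⟧ᴬ : Atom n → Env → Set
  ⟦ ahead d ⟧ᴬ      μ = orient d _<_ (μ x) (μ y)
  ⟦ thresh d a k ⟧ᴬ μ = orient d (thSem w (a , k)) (μ x) (μ y)
  ⟦ onY P ⟧ᴬ        μ = Sat betSem w μ (proj₁ P)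

  Holds : Proposition (Atom n) → ℕ → ℕ → Set
  Holds s i j = ⟦ s ⟧ (λ α → ⟦ α ⟧ᴬ ⟨ i , j ⟩)

  Clear : Dir → Proposition (Atom n) → ℕ → ℕ → Set
  Clear d s i j = All (λ c → ¬ orient d (betSem w c) i j) (positives d s)

  Sat-aheadF : ∀ d {i j} → Sat betSem w ⟨ i , j ⟩ (aheadF d) ⇔ orient d _<_ i j
  Sat-aheadF fw = ⇔-id _
  Sat-aheadF bw = ⇔-id _

  Sat-clearF : ∀ d s {i j} → Sat betSem w ⟨ i , j ⟩ (clearF d s) ⇔ Clear d s i j
  Sat-clearF fw s = Sat-⋀ betSem w _ (positives fw s) _
  Sat-clearF bw s = Sat-⋀ betSem w _ (positives bw s) _

  orient-thSem : ∀ d {a k i j} →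
    orient d (thSem w (a , k)) i j ⇔ (orient d _<_ i j × k ≤ orient d (countBetween w a) i j)
  orient-thSem fw = ⇔-id _
  orient-thSem bw = ⇔-id _

  orient-thSem-cong : ∀ d {a a′ k k′ i j i′ j′} → orient d _<_ i j → orient d _<_ i′ j′ →
    (k ≤ orient d (countBetween w a) i j ⇔ k′ ≤ orient d (countBetween w a′) i′ j′) →
    orient d (thSem w (a , k)) i j ⇔ orient d (thSem w (a′ , k′)) i′ j′
  orient-thSem-cong d ij i′j′ k⇔k′ = ⇔-sym (orient-thSem d) ⇔-∘ ((⊤-⇔ ij i′j′ ×-⇔ k⇔k′) ⇔-∘ orient-thSem d)

  thSem⇒ahead : ∀ d {b i j} → orient d (thSem w b) i j → orient d _<_ i j
  thSem⇒ahead fw = proj₁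
  thSem⇒ahead bw = proj₁

  thSem⇒betSem : ∀ d {a k i j} → orient d (thSem w (a , suc k)) i j → orient d (betSem w a) i j
  thSem⇒betSem fw (_ , k<count) = countBetween⇒betSem w _ (≤-trans (s≤s z≤n) k<count)
  thSem⇒betSem bw (_ , k<count) = countBetween⇒betSem w _ (≤-trans (s≤s z≤n) k<count)

  countBetween-skip-hit : ∀ d {a i z j} → orient d _<_ i z → orient d _<_ z j → letterAt w z ≡ just a →
    ¬ orient d (betSem w a) i z → orient d (countBetween w a) i j ≡ suc (orient d (countBetween w a) z j)
  countBetween-skip-hit fw {a} {i} {z} {j} i<z z<j a-at-z none = begin
    countBetween w a i j                               ≡⟨ countBetween-split-hit w a i<z z<j a-at-z ⟩
    countBetween w a i z + suc (countBetween w a z j)  ≡⟨ cong (_+ _) (¬betSem⇒countBetween≡0 w a none) ⟩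
    suc (countBetween w a z j)                         ∎
    where open ≡-Reasoning
  countBetween-skip-hit bw {a} {i} {z} {j} z<i j<z a-at-z none = begin
    countBetween w a j i                               ≡⟨ countBetween-split-hit w a j<z z<i a-at-z ⟩
    countBetween w a j z + suc (countBetween w a z i)
      ≡⟨ cong (λ m → countBetween w a j z + suc m) (¬betSem⇒countBetween≡0 w a none) ⟩
    countBetween w a j z + 1                           ≡⟨ +-comm _ 1 ⟩
    suc (countBetween w a j z)                         ∎
    where open ≡-Reasoning

  countBetween-skip-miss : ∀ d {a i z j} → orient d _<_ i z → orient d _<_ z j → letterAt w z ≢ just a →
    ¬ orient d (betSem w a) i z → orient d (countBetween w a) i j ≡ orient d (countBetween w a) z j
  countBetween-skip-miss fw {a} i<z z<j ¬a-at-z none =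
    trans (countBetween-split-miss w a i<z z<j ¬a-at-z) (cong (_+ _) (¬betSem⇒countBetween≡0 w a none))
  countBetween-skip-miss bw {a} z<i j<z ¬a-at-z none =
    trans (countBetween-split-miss w a j<z z<i ¬a-at-z)
          (trans (cong (_ +_) (¬betSem⇒countBetween≡0 w a none)) (+-identityʳ _))

  thSem-zero : ∀ d {a i j} → orient d (thSem w (a , 0)) i j ⇔ orient d _<_ i j
  thSem-zero d = mk⇔ (thSem⇒ahead d) (λ ij → from (orient-thSem d) (ij , z≤n))

  ∈-positives : ∀ d {s : Proposition (Atom n)} {α c} → α ∈ atoms s → c ∈ positive d α → c ∈ positives d s
  ∈-positives d α∈ c∈ = ∈-concatMap⁺ (positive d) (lose α∈ c∈)

  baseAtom-sound : ∀ d {i j} α → orient d _<_ i j → (∀ {c} → c ∈ positive d α → ¬ orient d (betSem w c) i j) →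
    Sat betSem w ⟨ i , j ⟩ (baseAtom d α) ⇔ ⟦ α ⟧ᴬ ⟨ i , j ⟩
  baseAtom-sound d (ahead d′)         i<j _ = ⇔-sym (ahead-dir d d′ i<j) ⇔-∘ Sat-decF betSem w _ (d ≟ᴰ d′)
  baseAtom-sound d (thresh d′ a zero) i<j _ =
    ⇔-sym (thSem-zero d′) ⇔-∘ (⇔-sym (ahead-dir d d′ i<j) ⇔-∘ Sat-decF betSem w _ (d ≟ᴰ d′))
  baseAtom-sound d {i} {j} (thresh d′ a (suc k)) i<j none with d ≟ᴰ d′
  ... | yes refl = ⊥-⇔ (Sat-⊥F betSem w ⟨ i , j ⟩) (none (here refl) ∘ thSem⇒betSem d)
  ... | no d≢d′  = ⊥-⇔ (Sat-⊥F betSem w ⟨ i , j ⟩) (d≢d′ ∘ to (ahead-dir d d′ i<j) ∘ thSem⇒ahead d′)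
  baseAtom-sound d (onY P)            _   _ = ⇔-id _

  realize-base-sound : ∀ d s {i j} → orient d _<_ i j → Clear d s i j →
    Sat betSem w ⟨ i , j ⟩ (realize (baseAtom d) s) ⇔ Holds s i j
  realize-base-sound d s i<j clear =
    ⟦⟧-cong s (λ {α} α∈ → baseAtom-sound d α i<j (All.lookup clear ∘ ∈-positives d {s = s} α∈))
      ⇔-∘ Sat-realize betSem w _ (baseAtom d) s

  shiftAtom-sound : ∀ d {c i z j} α → orient d _<_ i z → orient d _<_ z j → letterAt w z ≡ just c →
    (∀ {a} → a ∈ positive d α → ¬ orient d (betSem w a) i z) →
    ⟦ shiftAtom d c α ⟧ᴬ ⟨ z , j ⟩ ⇔ ⟦ α ⟧ᴬ ⟨ i , j ⟩
  shiftAtom-sound d (ahead d′) i<z z<j _ _ = ⇔-sym (ahead-dir d d′ (orient-trans d i<z z<j)) ⇔-∘ ahead-dir d d′ z<j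
  shiftAtom-sound d {c} (thresh d′ a zero) i<z z<j _ _ with d ≟ᴰ d′ | c F.≟ a
  ... | yes refl | yes refl = orient-thSem-cong d z<j (orient-trans d i<z z<j) (⊤-⇔ z≤n z≤n)
  ... | yes refl | no _     = orient-thSem-cong d z<j (orient-trans d i<z z<j) (⊤-⇔ z≤n z≤n)
  ... | no d≢d′  | _        = ⊥-⇔ (d≢d′ ∘ to (ahead-dir d d′ z<j) ∘ thSem⇒ahead d′)
                                  (d≢d′ ∘ to (ahead-dir d d′ (orient-trans d i<z z<j)) ∘ thSem⇒ahead d′)
  shiftAtom-sound d {c} (thresh d′ a (suc k)) i<z z<j c-at-z none with d ≟ᴰ d′ | c F.≟ a
  ... | yes refl | yes refl = orient-thSem-cong d z<j (orient-trans d i<z z<j)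
    (subst (λ m → k ≤ _ ⇔ suc k ≤ m) (sym (countBetween-skip-hit d i<z z<j c-at-z (none (here refl))))
           (mk⇔ s≤s s≤s⁻¹))
  ... | yes refl | no c≢a   = orient-thSem-cong d z<j (orient-trans d i<z z<j)
    (≡⇒⇔ (cong (suc k ≤_) (sym (countBetween-skip-miss d i<z z<j (c≢a ∘ MP.just-injective ∘ trans (sym c-at-z))
                                                                    (none (here refl))))))
  ... | no d≢d′  | _        = ⊥-⇔ (d≢d′ ∘ to (ahead-dir d d′ z<j) ∘ thSem⇒ahead d′)
                                  (d≢d′ ∘ to (ahead-dir d d′ (orient-trans d i<z z<j)) ∘ thSem⇒ahead d′)
  shiftAtom-sound d (onY P) _ _ _ _ = Sat-onlyFree betSem w (proj₁ P) (proj₂ P) refl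

  shift-sound : ∀ d {c} s {i z j} → orient d _<_ i z → orient d _<_ z j → letterAt w z ≡ just c → Clear d s i z →
    Holds (shift d c s) z j ⇔ Holds s i j
  shift-sound d {c} s i<z z<j c-at-z clear =
    ⟦⟧-cong s (λ {α} α∈ → shiftAtom-sound d α i<z z<j c-at-z (All.lookup clear ∘ ∈-positives d {s = s} α∈))
      ⇔-∘ ≡⇒⇔ (⟦mapᵖ⟧ (shiftAtom d c) s _)

  PositiveAt : Dir → Proposition (Atom n) → ℕ → Set
  PositiveAt d s z = Σ (Fin n) λ c → letterAt w z ≡ just c × c ∈ positives d s

  PositiveAt? : ∀ d s → Decidable (PositiveAt d s)
  PositiveAt? d s z with letterAt w z
  ... | nothing = no λ { (_ , () , _) }
  ... | just c  = map′ (λ c∈ → c , refl , c∈) (λ { (_ , refl , c∈) → c∈ })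
                       (DecMembership._∈?_ F._≟_ c (positives d s))

  None⇒clear : ∀ d s {i j} → None (PositiveAt d s) i j → All (λ c → ¬ betSem w c i j) (positives d s)
  None⇒clear d s none = All.tabulate λ c∈ (t , i<t , t<j , c-at-t) → none t i<t t<j (_ , c-at-t , c∈)

  nearest-positive : ∀ d s i j →
    Clear d s i j ⊎ Σ ℕ λ z → orient d _<_ i z × orient d _<_ z j × PositiveAt d s z × Clear d s i z
  nearest-positive fw s i j with least-between (PositiveAt? fw s) i j
  ... | inj₁ none                        = inj₁ (None⇒clear fw s none)
  ... | inj₂ (z , i<z , z<j , pos , none) = inj₂ (z , i<z , z<j , pos , None⇒clear fw s none)
  nearest-positive bw s i j with greatest-between (PositiveAt? bw s) j i
  ... | inj₁ none                        = inj₁ (None⇒clear bw s none)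
  ... | inj₂ (z , j<z , z<i , pos , none) = inj₂ (z , z<i , j<z , pos , None⇒clear bw s none)

  Sat-∃clear : ∀ d s ν → Sat betSem w ν (∃clear d s) ⇔
    Somewhere w (λ j → orient d _<_ (ν x) j × Clear d s (ν x) j × Holds s (ν x) j)
  Sat-∃clear d s ν =
    Somewhere-cong w (λ j → mk⇔ (sound j) (complete j)) ⇔-∘ Sat-∃y betSem w (aheadF d ∧' (clearF d s ∧' realize (baseAtom d) s)) ν
    where
    sound : ∀ j → Sat betSem w ⟨ ν x , j ⟩ (aheadF d ∧' (clearF d s ∧' realize (baseAtom d) s)) → _
    sound j (toward , clear , base) =
      let toward′ = to (Sat-aheadF d) toward ; clear′ = to (Sat-clearF d s) clear
      in toward′ , clear′ , to (realize-base-sound d s toward′ clear′) base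
    complete : ∀ j → orient d _<_ (ν x) j × Clear d s (ν x) j × Holds s (ν x) j →
      Sat betSem w ⟨ ν x , j ⟩ (aheadF d ∧' (clearF d s ∧' realize (baseAtom d) s))
    complete j (toward , clear , holds) =
      from (Sat-aheadF d) toward , from (Sat-clearF d s) clear , from (realize-base-sound d s toward clear) holds

  Sat-∃step : ∀ d s c φ ν → Sat betSem w ν (∃step d s c φ) ⇔
    Somewhere w (λ z → orient d _<_ (ν x) z × letterAt w z ≡ just c × Clear d s (ν x) z × Sat betSem w ⟨ z , ν x ⟩ φ)
  Sat-∃step d s c φ ν = Somewhere-cong w (λ z →
      Sat-aheadF d ×-⇔ (⇔-id _ ×-⇔ (Sat-clearF d s ×-⇔ (Sat-≗ betSem w φ swap ⇔-∘ Sat-swapVars betSem w φ _))))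
    ⇔-∘ Sat-∃y betSem w (aheadF d ∧' (letter c y ∧' (clearF d s ∧' swapVars φ))) ν
    where
    swap : ∀ {i z} → ⟨ i , z ⟩ ∘ other ≗ ⟨ z , i ⟩
    swap x = refl
    swap y = refl

  Reachable : Dir → Proposition (Atom n) → ℕ → Set
  Reachable d s i = Somewhere w (λ j → orient d _<_ i j × Holds s i j)

  ∃ahead-sound : ∀ d f s ν → Sat betSem w ν (∃ahead d f s) → Reachable d s (ν x)
  ∃ahead-sound d zero    s ν sat with j , l , u , toward , _ , holds ← to (Sat-∃clear d s ν) sat =
    j , l , u , toward , holds
  ∃ahead-sound d (suc f) s ν (inj₁ sat) = ∃ahead-sound d zero s ν sat
  ∃ahead-sound d (suc f) s ν (inj₂ sat)
    with c , _ , step                       ← find (to (Sat-⋁ betSem w ν (positives d s) _) sat)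
    with z , _ , _ , i<z , c-at-z , clear , rest ← to (Sat-∃step d s c (∃ahead d f (shift d c s)) ν) step
    with j , l , u , z<j , holds             ← ∃ahead-sound d f (shift d c s) ⟨ z , ν x ⟩ rest
    = j , l , u , orient-trans d i<z z<j , to (shift-sound d s i<z z<j c-at-z clear) holds

  ∃ahead-complete : ∀ d f s ν → measure d s ≤ f → Reachable d s (ν x) → Sat betSem w ν (∃ahead d f s)
  ∃ahead-complete d f s ν m≤f (j , l , u , i<j , holds) with nearest-positive d s (ν x) j | f
  ... | inj₁ clear | zero  = from (Sat-∃clear d s ν) (j , l , u , i<j , clear , holds)
  ... | inj₁ clear | suc _ = inj₁ (from (Sat-∃clear d s ν) (j , l , u , i<j , clear , holds))
  ... | inj₂ (z , i<z , z<j , (c , c-at-z , c∈) , clear) | zero =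
    ⊥-elim (n≮0 (<-≤-trans (measure-shift-< d s c∈) m≤f))
  ... | inj₂ (z , i<z , z<j , (c , c-at-z , c∈) , clear) | suc f =
    inj₂ (from (Sat-⋁ betSem w ν (positives d s) _) (lose c∈ (from (Sat-∃step d s c (∃ahead d f (shift d c s)) ν)
      (z , proj₁ z-range , proj₂ z-range , i<z , c-at-z , clear ,
       ∃ahead-complete d f (shift d c s) ⟨ z , ν x ⟩ (≤-pred (<-≤-trans (measure-shift-< d s c∈) m≤f))
         (j , l , u , z<j , from (shift-sound d s i<z z<j c-at-z clear) holds)))))
    where z-range = letterAt-range w z c-at-z

  diagAtom-sound : ∀ α {i} → Sat betSem w ⟨ i , i ⟩ (diagAtom α) ⇔ ⟦ α ⟧ᴬ ⟨ i , i ⟩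
  diagAtom-sound (ahead d)      {i} = ⊥-⇔ (Sat-⊥F betSem w ⟨ i , i ⟩) (orient-irrefl d)
  diagAtom-sound (thresh d a k) {i} = ⊥-⇔ (Sat-⊥F betSem w ⟨ i , i ⟩) (orient-irrefl d ∘ thSem⇒ahead d)
  diagAtom-sound (onY P)        = ⇔-id _

  elimLeaf-sound : ∀ s ν → Sat betSem w ν (elimLeaf s) ⇔ Somewhere w (Holds s (ν x))
  elimLeaf-sound s ν = mk⇔ sound complete
    where
    here-body : FObet n
    here-body = (¬' lt x y) ∧' ((¬' lt y x) ∧' realize diagAtom s)
    here-sound : ∀ {j} → Sat betSem w ⟨ j , j ⟩ (realize diagAtom s) ⇔ Holds s j j
    here-sound = ⟦⟧-cong s (λ {α} _ → diagAtom-sound α) ⇔-∘ Sat-realize betSem w _ diagAtom s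
    sound : Sat betSem w ν (elimLeaf s) → Somewhere w (Holds s (ν x))
    sound (inj₁ sat) with j , l , u , _ , holds ← ∃ahead-sound fw (measure fw s) s ν sat = j , l , u , holds
    sound (inj₂ (inj₁ sat)) with j , l , u , _ , holds ← ∃ahead-sound bw (measure bw s) s ν sat = j , l , u , holds
    sound (inj₂ (inj₂ sat)) with j , l , u , ¬i<j , ¬j<i , diag ← to (Sat-∃y betSem w here-body ν) sat
      with refl ← ≤-antisym (≮⇒≥ ¬j<i) (≮⇒≥ ¬i<j) = j , l , u , to here-sound diag
    complete : Somewhere w (Holds s (ν x)) → Sat betSem w ν (elimLeaf s)
    complete (j , l , u , holds) with <-cmp (ν x) j
    ... | tri< i<j _ _ = inj₁ (∃ahead-complete fw _ s ν ≤-refl (j , l , u , i<j , holds))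
    ... | tri> _ _ j<i = inj₂ (inj₁ (∃ahead-complete bw _ s ν ≤-refl (j , l , u , j<i , holds)))
    ... | tri≈ ¬i<j refl ¬j<i =
          inj₂ (inj₂ (from (Sat-∃y betSem w here-body ν) (j , l , u , ¬i<j , ¬j<i , from here-sound holds)))

  valuation : Env → FObet₁ n x → Bool
  valuation ν P = does (Sat? betSem w (betSem? w) ν (proj₁ P))

  elimTree-sound : ∀ t ν → Sat betSem w ν (elimTree t) ⇔ Somewhere w (Holds (select (valuation ν) t) (ν x))
  elimTree-sound (leaf s)     ν = elimLeaf-sound s ν
  elimTree-sound (node P t f) ν with Sat? betSem w (betSem? w) ν (proj₁ P)
  ... | yes p = mk⇔ [ to (elimTree-sound t ν) ∘ proj₂ , (λ (¬p , _) → ⊥-elim (¬p p)) ]′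
                    (λ holds → inj₁ (p , from (elimTree-sound t ν) holds))
  ... | no ¬p = mk⇔ [ (λ (p , _) → ⊥-elim (¬p p)) , to (elimTree-sound f ν) ∘ proj₂ ]′
                    (λ holds → inj₂ (¬p , from (elimTree-sound f ν) holds))

  ⟦_⟧ˢ : Skeleton n → Env → Set
  ⟦ s ⟧ˢ μ = ⟦ s ⟧ [ (λ P → Sat betSem w μ (proj₁ P)) , (λ α → ⟦ α ⟧ᴬ μ) ]′

  elim∃y-sound : ∀ s ν → Sat betSem w ν (elim∃y s) ⇔ Somewhere w (λ j → ⟦ s ⟧ˢ ⟨ ν x , j ⟩)
  elim∃y-sound s ν = begin
    Sat betSem w ν (elim∃y s)
      ∼⟨ elimTree-sound (shannon s) ν ⟩
    Somewhere w (Holds (select (valuation ν) (shannon s)) (ν x))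
      ≡⟨ cong (λ p → Somewhere w (Holds p (ν x))) (select-shannon (valuation ν) s) ⟩
    Somewhere w (Holds (instantiate (valuation ν) s) (ν x))
      ∼⟨ Somewhere-cong w (λ j → x-atoms j ⇔-∘ ⟦instantiate⟧ (λ P → Sat? betSem w (betSem? w) ν (proj₁ P)) _ s) ⟩
    Somewhere w (λ j → ⟦ s ⟧ˢ ⟨ ν x , j ⟩)
      ∎
    where
    open EquationalReasoning
    x-atoms : ∀ j → ⟦ s ⟧ [ (λ P → Sat betSem w ν (proj₁ P)) , (λ α → ⟦ α ⟧ᴬ ⟨ ν x , j ⟩) ]′ ⇔ ⟦ s ⟧ˢ ⟨ ν x , j ⟩
    x-atoms j = ⟦⟧-cong s λ { {inj₁ P} _ → Sat-onlyFree betSem w (proj₁ P) (proj₂ P) refl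
                            ; {inj₂ α} _ → ⇔-id _ }

-- The translations

-- renames the variables so that the given one becomes y
toY : Var → Var → Var
toY y v = v
toY x v = other v

rename : {B : Set} → Var → Form n B → Form n B
rename y φ = φ
rename x φ = swapVars φ

rename-onlyFree : ∀ {B} p {v} (φ : Form n B) → OnlyFree v φ → OnlyFree (toY p v) (rename p φ)
rename-onlyFree y φ h = h
rename-onlyFree x φ h = swapVars-onlyFree φ h

rename-elim∃y-onlyFree : ∀ q (s : Skeleton n) → OnlyFree (other q) (rename q (elim∃y s))
rename-elim∃y-onlyFree x s = swapVars-onlyFree (elim∃y s) (elim∃y-onlyFree s)
rename-elim∃y-onlyFree y s = elim∃y-onlyFree s

Sat-rename : ∀ {B} (I : Word n → B → ℕ → ℕ → Set) w p φ ν → Sat I w ν (rename p φ) ⇔ Sat I w (ν ∘ toY p) φ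
Sat-rename I w y φ ν = ⇔-id _
Sat-rename I w x φ ν = Sat-swapVars I w φ ν

order : Var → Var → Skeleton n
order x y = atom (inj₂ (ahead fw))
order y x = atom (inj₂ (ahead bw))
order x x = ⊥ᵖ
order y y = ⊥ᵖ

threshold : Fin n → ℕ → Var → Var → Skeleton n
threshold a k x y = atom (inj₂ (thresh fw a k))
threshold a k y x = atom (inj₂ (thresh bw a k))
threshold a k x x = ⊥ᵖ
threshold a k y y = ⊥ᵖ

unary : (v : Var) (φ : FObet n) → OnlyFree v φ → Skeleton n
unary x φ h = atom (inj₁ (φ , h))
unary y φ h = atom (inj₂ (onY (φ , h)))

quantified : Var → (q : Var) (φ : FObet n) → OnlyFree (other q) φ → Skeleton n
quantified p q φ h = unary (toY p (other q)) (rename p φ) (rename-onlyFree p φ h)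

mutual
  thToBet : FOth n → FObet n
  thToBet (lt u v)     = lt u v
  thToBet (letter a u) = letter a u
  -- thToBet is only used under environments giving x and y the same value (sentences and
  -- formulas in one variable), where binary atoms are false; binary atoms between distinct
  -- positions are translated inside skeletons
  thToBet (bin b u v)  = ⊥F
  thToBet (¬' φ)       = ¬' thToBet φ
  thToBet (φ ∧' ψ)     = thToBet φ ∧' thToBet ψ
  thToBet (φ ∨' ψ)     = thToBet φ ∨' thToBet ψ
  thToBet (∃' q φ)     = thToBet∃ q φ (Free? (other q) φ)
  thToBet (∀' q φ)     = thToBet∀ q φ (Free? (other q) φ)

  thToBet∃ : ∀ q (φ : FOth n) → Dec (Free (other q) φ) → FObet n
  thToBet∃ q φ (yes _) = rename q (elim∃y (skeleton q φ))
  thToBet∃ q φ (no _)  = ∃' q (thToBet φ)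

  thToBet∀ : ∀ q (φ : FOth n) → Dec (Free (other q) φ) → FObet n
  thToBet∀ q φ (yes _) = ¬' rename q (elim∃y (¬ᵖ skeleton q φ))
  thToBet∀ q φ (no _)  = ∀' q (thToBet φ)

  thToBet∃-onlyFree : ∀ q (φ : FOth n) free? → OnlyFree (other q) (thToBet∃ q φ free?)
  thToBet∃-onlyFree q φ (yes _) = rename-elim∃y-onlyFree q (skeleton q φ)
  thToBet∃-onlyFree q φ (no _)  = ∃-onlyFree q (thToBet φ)

  thToBet∀-onlyFree : ∀ q (φ : FOth n) free? → OnlyFree (other q) (thToBet∀ q φ free?)
  thToBet∀-onlyFree q φ (yes _) = rename-elim∃y-onlyFree q (¬ᵖ skeleton q φ)
  thToBet∀-onlyFree q φ (no _)  = λ v (v≢q , _) → ≢⇒≡other v≢q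

  skeleton : Var → FOth n → Skeleton n
  skeleton p (lt u v)          = order (toY p u) (toY p v)
  skeleton p (letter a u)      = unary (toY p u) (letter a (toY p u)) λ _ eq → eq
  skeleton p (bin (a , k) u v) = threshold a k (toY p u) (toY p v)
  skeleton p (¬' φ)            = ¬ᵖ skeleton p φ
  skeleton p (φ ∧' ψ)          = skeleton p φ ∧ᵖ skeleton p ψ
  skeleton p (φ ∨' ψ)          = skeleton p φ ∨ᵖ skeleton p ψ
  skeleton p (∃' q φ)          = quantified p q (thToBet∃ q φ free?) (thToBet∃-onlyFree q φ free?)
    where free? = Free? (other q) φ
  skeleton p (∀' q φ)          = quantified p q (thToBet∀ q φ free?) (thToBet∀-onlyFree q φ free?)
    where free? = Free? (other q) φ

mutual
  thToBet-free : ∀ {n} (φ : FOth n) v → Free v (thToBet φ) → Free v φ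
  thToBet-free (lt u u′)    v fr        = fr
  thToBet-free (letter a u) v fr        = fr
  thToBet-free {n} (bin b u u′) v fr    = ⊥-elim (⊥F-closed {B = Fin n} {n} v fr)
  thToBet-free (¬' φ)       v fr        = thToBet-free φ v fr
  thToBet-free (φ ∧' ψ)     v (inj₁ fr) = inj₁ (thToBet-free φ v fr)
  thToBet-free (φ ∧' ψ)     v (inj₂ fr) = inj₂ (thToBet-free ψ v fr)
  thToBet-free (φ ∨' ψ)     v (inj₁ fr) = inj₁ (thToBet-free φ v fr)
  thToBet-free (φ ∨' ψ)     v (inj₂ fr) = inj₂ (thToBet-free ψ v fr)
  thToBet-free (∃' q φ)     v fr        = thToBet∃-free q φ (Free? (other q) φ) v fr
  thToBet-free (∀' q φ)     v fr        = thToBet∀-free q φ (Free? (other q) φ) v fr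

  thToBet∃-free : ∀ q (φ : FOth n) free? v → Free v (thToBet∃ q φ free?) → Free v (∃' q φ)
  thToBet∃-free q φ (yes free) v fr with refl ← thToBet∃-onlyFree q φ (yes free) v fr = other-≢ q , free
  thToBet∃-free q φ (no _)     v (v≢q , fr) = v≢q , thToBet-free φ v fr

  thToBet∀-free : ∀ q (φ : FOth n) free? v → Free v (thToBet∀ q φ free?) → Free v (∀' q φ)
  thToBet∀-free q φ (yes free) v fr with refl ← thToBet∀-onlyFree q φ (yes free) v fr = other-≢ q , free
  thToBet∀-free q φ (no _)     v (v≢q , fr) = v≢q , thToBet-free φ v fr

module _ (w : Word n) where
  open Semantics w

  order-sound : ∀ u v μ → (μ u < μ v) ⇔ ⟦ order u v ⟧ˢ μ
  order-sound x x μ = ⊥-⇔ (<-irrefl refl) id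
  order-sound x y μ = ⇔-id _
  order-sound y x μ = ⇔-id _
  order-sound y y μ = ⊥-⇔ (<-irrefl refl) id

  threshold-sound : ∀ a k u v μ → thSem w (a , k) (μ u) (μ v) ⇔ ⟦ threshold a k u v ⟧ˢ μ
  threshold-sound a k x x μ = ⊥-⇔ (<-irrefl refl ∘ proj₁) id
  threshold-sound a k x y μ = ⇔-id _
  threshold-sound a k y x μ = ⇔-id _
  threshold-sound a k y y μ = ⊥-⇔ (<-irrefl refl ∘ proj₁) id

  unary-sound : ∀ v φ h μ → ⟦ unary v φ h ⟧ˢ μ ⇔ Sat betSem w μ φ
  unary-sound x φ h μ = ⇔-id _
  unary-sound y φ h μ = ⇔-id _

  quantified-sound : ∀ p q φ h μ → ⟦ quantified p q φ h ⟧ˢ μ ⇔ Sat betSem w (μ ∘ toY p) φ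
  quantified-sound p q φ h μ = Sat-rename betSem w p φ μ ⇔-∘ unary-sound (toY p (other q)) (rename p φ) _ μ

  [↦]≗toY : ∀ (ν : Env) q j → ν [ q ↦ j ] ≗ ⟨ ν (toY q x) , j ⟩ ∘ toY q
  [↦]≗toY ν x j x = refl
  [↦]≗toY ν x j y = refl
  [↦]≗toY ν y j x = refl
  [↦]≗toY ν y j y = refl

  mutual
    thToBet-sound : ∀ φ i → Sat thSem w (λ _ → i) φ ⇔ Sat betSem w (λ _ → i) (thToBet φ)
    thToBet-sound (lt u v)          i = ⇔-id _
    thToBet-sound (letter a u)      i = ⇔-id _
    thToBet-sound (bin (a , k) u v) i = ⊥-⇔ (<-irrefl refl ∘ proj₁) (Sat-⊥F betSem w (λ _ → i))
    thToBet-sound (¬' φ)            i = ¬-cong-⇔ (thToBet-sound φ i)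
    thToBet-sound (φ ∧' ψ)          i = thToBet-sound φ i ×-⇔ thToBet-sound ψ i
    thToBet-sound (φ ∨' ψ)          i = thToBet-sound φ i ⊎-⇔ thToBet-sound ψ i
    thToBet-sound (∃' q φ)          i = thToBet∃-sound q φ (Free? (other q) φ) (λ _ → i)
    thToBet-sound (∀' q φ)          i = thToBet∀-sound q φ (Free? (other q) φ) (λ _ → i)

    thToBet-sound-onlyFree : ∀ q φ → OnlyFree q φ → ∀ ν j →
      Sat thSem w (ν [ q ↦ j ]) φ ⇔ Sat betSem w (ν [ q ↦ j ]) (thToBet φ)
    thToBet-sound-onlyFree q φ only ν j =
      ⇔-sym (Sat-onlyFree betSem w (thToBet φ) (λ v → only v ∘ thToBet-free φ v) ([↦]-same ν q j))
        ⇔-∘ (thToBet-sound φ j ⇔-∘ Sat-onlyFree thSem w φ only ([↦]-same ν q j))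

    skeleton-at : ∀ q φ ν j → Sat thSem w (ν [ q ↦ j ]) φ ⇔ ⟦ skeleton q φ ⟧ˢ ⟨ ν (toY q x) , j ⟩
    skeleton-at q φ ν j = skeleton-sound q φ ⟨ ν (toY q x) , j ⟩ ⇔-∘ Sat-≗ thSem w φ ([↦]≗toY ν q j)

    thToBet∃-sound : ∀ q φ free? ν → Sat thSem w ν (∃' q φ) ⇔ Sat betSem w ν (thToBet∃ q φ free?)
    thToBet∃-sound q φ (yes _) ν = begin
      Sat thSem w ν (∃' q φ)
        ∼⟨ Somewhere-cong w (skeleton-at q φ ν) ⟩
      Somewhere w (λ j → ⟦ skeleton q φ ⟧ˢ ⟨ ν (toY q x) , j ⟩)
        ∼⟨ ⇔-sym (elim∃y-sound (skeleton q φ) (ν ∘ toY q)) ⟩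
      Sat betSem w (ν ∘ toY q) (elim∃y (skeleton q φ))
        ∼⟨ ⇔-sym (Sat-rename betSem w q _ ν) ⟩
      Sat betSem w ν (rename q (elim∃y (skeleton q φ)))
        ∎
      where open EquationalReasoning
    thToBet∃-sound q φ (no ¬free) ν = Somewhere-cong w (thToBet-sound-onlyFree q φ (¬Free-other⇒onlyFree φ ¬free) ν)

    thToBet∀-sound : ∀ q φ free? ν → Sat thSem w ν (∀' q φ) ⇔ Sat betSem w ν (thToBet∀ q φ free?)
    thToBet∀-sound q φ (yes _) ν = begin
      Sat thSem w ν (∀' q φ)
        ∼⟨ Everywhere⇔¬Somewhere¬ w (λ j → Sat? thSem w (thSem? w) (ν [ q ↦ j ]) φ) ⟩
      ¬ Somewhere w (λ j → ¬ Sat thSem w (ν [ q ↦ j ]) φ)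
        ∼⟨ ¬-cong-⇔ (Somewhere-cong w (¬-cong-⇔ ∘ skeleton-at q φ ν)) ⟩
      ¬ Somewhere w (λ j → ⟦ ¬ᵖ skeleton q φ ⟧ˢ ⟨ ν (toY q x) , j ⟩)
        ∼⟨ ¬-cong-⇔ (⇔-sym (elim∃y-sound (¬ᵖ skeleton q φ) (ν ∘ toY q))) ⟩
      ¬ Sat betSem w (ν ∘ toY q) (elim∃y (¬ᵖ skeleton q φ))
        ∼⟨ ¬-cong-⇔ (⇔-sym (Sat-rename betSem w q _ ν)) ⟩
      Sat betSem w ν (¬' rename q (elim∃y (¬ᵖ skeleton q φ)))
        ∎
      where open EquationalReasoning
    thToBet∀-sound q φ (no ¬free) ν = Everywhere-cong w (thToBet-sound-onlyFree q φ (¬Free-other⇒onlyFree φ ¬free) ν)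

    skeleton-sound : ∀ p φ μ → Sat thSem w (μ ∘ toY p) φ ⇔ ⟦ skeleton p φ ⟧ˢ μ
    skeleton-sound p (lt u v)          μ = order-sound (toY p u) (toY p v) μ
    skeleton-sound p (letter a u)      μ = ⇔-sym (unary-sound (toY p u) (letter a (toY p u)) _ μ)
    skeleton-sound p (bin (a , k) u v) μ = threshold-sound a k (toY p u) (toY p v) μ
    skeleton-sound p (¬' φ)            μ = ¬-cong-⇔ (skeleton-sound p φ μ)
    skeleton-sound p (φ ∧' ψ)          μ = skeleton-sound p φ μ ×-⇔ skeleton-sound p ψ μ
    skeleton-sound p (φ ∨' ψ)          μ = skeleton-sound p φ μ ⊎-⇔ skeleton-sound p ψ μ
    skeleton-sound p (∃' q φ)          μ =
      ⇔-sym (quantified-sound p q _ _ μ) ⇔-∘ thToBet∃-sound q φ (Free? (other q) φ) (μ ∘ toY p)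
    skeleton-sound p (∀' q φ)          μ =
      ⇔-sym (quantified-sound p q _ _ μ) ⇔-∘ thToBet∀-sound q φ (Free? (other q) φ) (μ ∘ toY p)

  betToTh-sound : ∀ φ ν → Sat betSem w ν φ ⇔ Sat thSem w ν (mapBin (_, 1) φ)
  betToTh-sound = Sat-mapBin betSem w thSem (_, 1) λ a i j →
    mk⇔ (λ between@(_ , i<z , z<j , _) → <-trans i<z z<j , betSem⇒countBetween w a between)
        (countBetween⇒betSem w a ∘ proj₂)

betToTh : FObet n → FOth n
betToTh = mapBin (_, 1)

theorem2p6 : (n : ℕ) →
    ((φ : FObet n) → IsSentence φ → Σ (FOth n) λ ψ → IsSentence ψ × SentEquiv φ ψ)
    × ((ψ : FOth n) → IsSentence ψ → Σ (FObet n) λ φ → IsSentence φ × SentEquiv φ ψ)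
    × ((φ : FObet n) → IsFormula1 φ → Σ (FOth n) λ ψ → IsFormula1 ψ × Form1Equiv φ ψ)
    × ((ψ : FOth n) → IsFormula1 ψ → Σ (FObet n) λ φ → IsFormula1 φ × Form1Equiv φ ψ)
theorem2p6 n =
    (λ φ closed → betToTh φ , (λ v → closed v ∘ Free-mapBin _ φ v) , λ w → betToTh-sound w φ _)
  , (λ ψ closed → thToBet ψ , (λ v → closed v ∘ thToBet-free ψ v) , λ w → ⇔-sym (thToBet-sound w ψ 0))
  , (λ φ unary → betToTh φ , (λ v → unary v ∘ Free-mapBin _ φ v) , λ w i _ _ → betToTh-sound w φ _)
  , (λ ψ unary → thToBet ψ , (λ v → unary v ∘ thToBet-free ψ v) , λ w i _ _ → ⇔-sym (thToBet-sound w ψ i))
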